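{- If $\mathcal{A}$ is a path object and $\mathcal{B}$ is a univalent displayed reflexive graph over $\mathcal{A}$, then the total reflexive graph $\mathcal{A}.\mathcal{B}$ is a path object.
   Context: Intensional Martin-Löf type theory with $\Pi,\Sigma$, identity types. A reflexive graph $\mathcal{G}$: type $|\mathcal{G}|$, edge types $x\approx_{\mathcal{G}}y$, $\mathsf{rx}_{\mathcal{G}}(x):x\approx_{\mathcal{G}}x$; a path object (univalent) if every fan $\sum_yx\approx_{\mathcal{G}}y$ is a proposition. A displayed reflexive graph $\mathcal{B}$ over $\mathcal{A}$: types $|\mathcal{B}|(x)$, types $u\approx^{\mathcal{B}}_pv$ for $p:x\approx_{\mathcal{A}}y$, $u:|\mathcal{B}|(x)$, $v:|\mathcal{B}|(y)$, and $\mathsf{rx}^{\mathcal{B}}_x(u):u\approx^{\mathcal{B}}_{\mathsf{rx}_{\mathcal{A}}(x)}u$; it is univalent if each component $\mathcal{B}(x)$ (vertices $|\mathcal{B}|(x)$, edges $u\approx^{\mathcal{B}}_{\mathsf{rx}_{\mathcal{A}}(x)}v$, reflexivity $\mathsf{rx}^{\mathcal{B}}_x$) is univalent. The total reflexive graph $\mathcal{A}.\mathcal{B}$ has vertices $\sum_{x:|\mathcal{A}|}|\mathcal{B}|(x)$, edges $(x,u)\approx(y,v):=\sum_{p:x\approx_{\mathcal{A}}y}u\approx^{\mathcal{B}}_pv$, and reflexivity $(\mathsf{rx}_{\mathcal{A}}(x),\mathsf{rx}^{\mathcal{B}}_x(u))$. -}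

{-# OPTIONS --without-K #-}
module Defs where

open import Level using (Level; _⊔_; suc)
open import Data.Product using (Σ; _,_; proj₁; proj₂)
open import Relation.Binary.PropositionalEquality using (_≡_)

isProp : ∀ {ℓ} → Set ℓ → Set ℓ
isProp A = (a b : A) → a ≡ b

record ReflGraph (ℓv ℓe : Level) : Set (suc (ℓv ⊔ ℓe)) where
  field
    V  : Set ℓv
    _≈_ : V → V → Set ℓe
    rx : (x : V) → x ≈ x

open ReflGraph public

isPathObject : ∀ {ℓv ℓe} → ReflGraph ℓv ℓe → Set (ℓv ⊔ ℓe)
isPathObject G = (x : V G) → isProp (Σ (V G) (λ y → _≈_ G x y))

record DispReflGraph {ℓv ℓe : Level} (A : ReflGraph ℓv ℓe) (ℓv' ℓe' : Level)
       : Set (ℓv ⊔ ℓe ⊔ suc (ℓv' ⊔ ℓe')) where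
  field
    B   : V A → Set ℓv'
    Edge : {x y : V A} → _≈_ A x y → B x → B y → Set ℓe'
    drx : (x : V A) (u : B x) → Edge (rx A x) u u

open DispReflGraph public

component : ∀ {ℓv ℓe ℓv' ℓe'} {A : ReflGraph ℓv ℓe} →
            DispReflGraph A ℓv' ℓe' → V A → ReflGraph ℓv' ℓe'
component {A = A} 𝓑 x = record
  { V = B 𝓑 x
  ; _≈_ = λ u v → Edge 𝓑 (rx A x) u v
  ; rx = drx 𝓑 x
  }

isUnivalentDisp : ∀ {ℓv ℓe ℓv' ℓe'} {A : ReflGraph ℓv ℓe} →
                  DispReflGraph A ℓv' ℓe' → Set (ℓv ⊔ ℓv' ⊔ ℓe')
isUnivalentDisp {A = A} 𝓑 = (x : V A) → isPathObject (component 𝓑 x)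

total : ∀ {ℓv ℓe ℓv' ℓe'} (A : ReflGraph ℓv ℓe) →
        DispReflGraph A ℓv' ℓe' → ReflGraph (ℓv ⊔ ℓv') (ℓe ⊔ ℓe')
total A 𝓑 = record
  { V = Σ (V A) (B 𝓑)
  ; _≈_ = λ xu yv → Σ (_≈_ A (proj₁ xu) (proj₁ yv))
                      (λ p → Edge 𝓑 p (proj₂ xu) (proj₂ yv))
  ; rx = λ xu → (rx A (proj₁ xu) , drx 𝓑 (proj₁ xu) (proj₂ xu))
  }

{-# OPTIONS --safe --without-K #-}
module Submission where

-- The fan of (x , u) in A.B fibres over the fan of x in A, with fibre over (y , p) the
-- displayed fan Σ v, u ≈ᴮₚ v.  The base fan is a proposition containing (x , rx x), so
-- every point of it equals that one, and there the displayed fan is the fan of u in the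
-- component B(x), a proposition by univalence of B.  A Σ of propositions over a
-- proposition is a proposition.

open import Level using (Level; _⊔_)
open import Data.Product using (Σ; _,_)
open import Data.Product.Properties using (Σ-≡,≡→≡)
open import Relation.Binary.PropositionalEquality using (_≡_; refl; sym; trans; cong; subst)

open import Defs

private
  variable
    a b ℓv ℓe ℓv' ℓe' : Level
    X : Set a
    Y : Set b

Σ-isProp : {P : X → Set b} → isProp X → (∀ x → isProp (P x)) → isProp (Σ X P)
Σ-isProp X-prop P-prop (x , p) (y , q) = Σ-≡,≡→≡ (X-prop x y , P-prop y _ q)

isProp-retract : (f : X → Y) (g : Y → X) → (∀ x → g (f x) ≡ x) → isProp Y → isProp X
isProp-retract f g gf≡id Y-prop x x′ =
  trans (sym (gf≡id x)) (trans (cong g (Y-prop (f x) (f x′))) (gf≡id x′))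

Fan : (G : ReflGraph ℓv ℓe) → V G → Set (ℓv ⊔ ℓe)
Fan G x = Σ (V G) (_≈_ G x)

DisplayedFan : {A : ReflGraph ℓv ℓe} (𝓑 : DispReflGraph A ℓv' ℓe') {x : V A} →
               B 𝓑 x → Fan A x → Set (ℓv' ⊔ ℓe')
DisplayedFan 𝓑 u (y , p) = Σ (B 𝓑 y) (Edge 𝓑 p u)

module _ (A : ReflGraph ℓv ℓe) (𝓑 : DispReflGraph A ℓv' ℓe') {x : V A} (u : B 𝓑 x) where

  totalFan→Σ-displayedFan : Fan (total A 𝓑) (x , u) → Σ (Fan A x) (DisplayedFan 𝓑 u)
  totalFan→Σ-displayedFan ((y , v) , (p , e)) = (y , p) , (v , e)

  Σ-displayedFan→totalFan : Σ (Fan A x) (DisplayedFan 𝓑 u) → Fan (total A 𝓑) (x , u)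
  Σ-displayedFan→totalFan ((y , p) , (v , e)) = (y , v) , (p , e)

  isProp-displayedFan : isPathObject A → isPathObject (component 𝓑 x) →
                        (w : Fan A x) → isProp (DisplayedFan 𝓑 u w)
  isProp-displayedFan A-path Bx-path w =
    subst (λ w → isProp (DisplayedFan 𝓑 u w)) (A-path x (x , rx A x) w) (Bx-path u)

mainTheorem13 : ∀ {ℓv ℓe ℓv' ℓe'} (A : ReflGraph ℓv ℓe) (𝓑 : DispReflGraph A ℓv' ℓe') →
    isPathObject A → isUnivalentDisp 𝓑 → isPathObject (total A 𝓑)
mainTheorem13 A 𝓑 A-path 𝓑-univalent (x , u) =
  isProp-retract (totalFan→Σ-displayedFan A 𝓑 u) (Σ-displayedFan→totalFan A 𝓑 u) (λ _ → refl)
    (Σ-isProp (A-path x) (isProp-displayedFan A 𝓑 u A-path (𝓑-univalent x)))
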